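{- Let $n\ge1$, $\rho=[n,n-1,\dots,1]$, and let $A$ be an admissible state of the ice model $\mathfrak B^\rho$ described in the context, with associated $2n\times 2n$ matrix $\hat A=(\hat a_{ij})$. Then the total number of vertices of $A$ of type $b_1$ or $b_2$ equals $i(\hat A)-s(\hat A)$, where $i(\hat A)=\sum_{i<k,\ j>l}\hat a_{ij}\hat a_{kl}$ is the inversion number of $\hat A$ and $s(\hat A)$ is the number of entries of $\hat A$ equal to $-1$.
   Context: The model $\mathfrak B^\rho$: a planar graph with $2n$ horizontal lines (rows) labelled top to bottom $1,\dots,n,\bar n,\dots,\bar1$ and $n$ vertical lines (columns) numbered $1,\dots,n$ from right to left; row–column crossings are tetravalent vertices. For each $j$ the right end of row $j$ is joined to the right end of row $\bar j$ by a nested arc (bend) carrying one bivalent vertex. An admissible state is an orientation of all edges such that each tetravalent vertex has two incoming and two outgoing edges, each bend vertex has one incoming and one outgoing edge, the left end of each row points rightward (inward), the bottom end of each column points down, and the top end of each column points up. The type of a tetravalent vertex: $a_1$ if both horizontal edges point right and both vertical edges down; $a_2$ if horizontal left, vertical up; $b_1$ if horizontal right, vertical up; $b_2$ if horizontal left, vertical down; $c_1$ if both horizontal edges point away from the vertex and both vertical edges toward it; $c_2$ if both horizontal edges point toward the vertex and both vertical edges away from it. The matrix $\hat A$: index its rows $1,\dots,2n$ top to bottom, corresponding to the row labels $1,\dots,n,\bar n,\dots,\bar1$ in that order. For $1\le c\le n$ let $\hat a_{r,c}=1$ if the vertex of $A$ on matrix-row $r$ and column numbered $n+1-c$ has type $c_2$,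 $\hat a_{r,c}=-1$ if it has type $c_1$, and $\hat a_{r,c}=0$ otherwise; for $n<c\le 2n$ set $\hat a_{r,c}=\hat a_{2n+1-r,\,2n+1-c}$ (half-turn symmetry). ($\hat A$ is then a half-turn symmetric alternating sign matrix.) -}

module Defs where

open import Data.Nat using (ℕ; zero; suc; _+_)
open import Data.Integer as ℤ using (ℤ; +_; -_)
open import Data.Fin using (Fin; zero; suc; inject₁; fromℕ; opposite; splitAt; _<?_)
open import Data.Bool using (Bool; true; false; if_then_else_; _∧_; _∨_; not)
open import Data.Sum using (inj₁; inj₂)
open import Relation.Nullary.Decidable using (⌊_⌋)
open import Relation.Binary.PropositionalEquality using (_≡_; _≢_)

Σℤ : ∀ {m} → (Fin m → ℤ) → ℤ
Σℤ {zero}  f = + 0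
Σℤ {suc m} f = f zero ℤ.+ Σℤ (λ i → f (suc i))

Σℕ : ∀ {m} → (Fin m → ℕ) → ℕ
Σℕ {zero}  f = 0
Σℕ {suc m} f = f zero + Σℕ (λ i → f (suc i))

ind : Bool → ℕ
ind b = if b then 1 else 0

-- Rows: r : Fin (n + n), index 0..2n-1 top to bottom = labels 1..n, n̄..1̄.
-- Columns: p : Fin n, position from the LEFT (p = 0 is column numbered n;
--   position p is the column numbered n - p, i.e. matrix column c = p + 1).
-- Horizontal edges of row r: k : Fin (suc n), edge k lies immediately left
--   of the vertex at position k (k = 0: left end; k = n: right end, going
--   into the bend).  Value true = edge points right.
-- Vertical edges of column p: k : Fin (suc (n + n)), edge k lies immediately
--   above the vertex on row k (k = 0: top end; k = 2n: bottom end).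
--   Value true = edge points down.

record Orientation (n : ℕ) : Set where
  field
    H : Fin (n + n) → Fin (suc n) → Bool
    V : Fin n → Fin (suc (n + n)) → Bool

module _ {n : ℕ} (o : Orientation n) where
  open Orientation o

  L R T B : Fin (n + n) → Fin n → Bool
  L r p = H r (inject₁ p)
  R r p = H r (suc p)
  T r p = V p (inject₁ r)
  B r p = V p (suc r)

  inDeg : Fin (n + n) → Fin n → ℕ
  inDeg r p = (if L r p then 1 else 0) + (if not (R r p) then 1 else 0)
            + (if T r p then 1 else 0) + (if not (B r p) then 1 else 0)

  isA₁ isA₂ isB₁ isB₂ isC₁ isC₂ : Fin (n + n) → Fin n → Bool
  isA₁ r p = L r p ∧ R r p ∧ T r p ∧ B r p
  isA₂ r p = not (L r p) ∧ not (R r p) ∧ not (T r p) ∧ not (B r p)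
  isB₁ r p = L r p ∧ R r p ∧ not (T r p) ∧ not (B r p)
  isB₂ r p = not (L r p) ∧ not (R r p) ∧ T r p ∧ B r p
  isC₁ r p = not (L r p) ∧ R r p ∧ T r p ∧ not (B r p)
  isC₂ r p = L r p ∧ not (R r p) ∧ not (T r p) ∧ B r p

-- Bend: row r (label j) and row opposite r (label j̄) have their right ends
-- joined through a bivalent vertex with one in, one out edge; thus exactly
-- one of the two right-end edges points right (into the bend).
record Admissible {n : ℕ} (o : Orientation n) : Set where
  open Orientation o
  field
    ice      : ∀ r p → inDeg o r p ≡ 2
    leftIn   : ∀ r → H r zero ≡ true
    topUp    : ∀ p → V p zero ≡ false
    bottomDn : ∀ p → V p (fromℕ (n + n)) ≡ true
    bend     : ∀ r → H r (fromℕ n) ≢ H (opposite r) (fromℕ n)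

vEntry : ∀ {n} → Orientation n → Fin (n + n) → Fin n → ℤ
vEntry o r p =
  if isC₂ o r p then + 1 else (if isC₁ o r p then - (+ 1) else + 0)

-- Â (0-indexed): column c < n is the vertex on row r at position c from the
-- left (= column numbered n + 1 - (c+1)); column c = n + q uses half-turn
-- symmetry: Â[r][n+q] = Â[2n-1-r][2n-1-(n+q)] = Â[opposite r][opposite q].
Ahat : ∀ {n} → Orientation n → Fin (n + n) → Fin (n + n) → ℤ
Ahat {n} o r c with splitAt n c
... | inj₁ p = vEntry o r p
... | inj₂ q = vEntry o (opposite r) (opposite q)

inv : ∀ {m} → (Fin m → Fin m → ℤ) → ℤ
inv M = Σℤ λ i → Σℤ λ j → Σℤ λ k → Σℤ λ l →
  if ⌊ i <? k ⌋ ∧ ⌊ l <? j ⌋ then M i j ℤ.* M k l else + 0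

isMinusOne : ℤ → Bool
isMinusOne (ℤ.-[1+ zero ]) = true
isMinusOne _ = false

negCount : ∀ {m} → (Fin m → Fin m → ℤ) → ℕ
negCount M = Σℕ λ i → Σℕ λ j → ind (isMinusOne (M i j))

bCount : ∀ {n} → Orientation n → ℕ
bCount o = Σℕ λ r → Σℕ λ p → ind (isB₁ o r p ∨ isB₂ o r p)

-- Along each row of Â the entries are differences of the indicators of consecutive horizontal
-- edges pointing right, and along each column of those of consecutive vertical edges pointing
-- down; the right half of Â is the half-turn image of the left half, and the bend glues the two
-- halves of a row. Hence the sum of the entries before a given one in its column, resp. row, is an
-- edge indicator at the corresponding vertex, and i(Â) = Σ_{k,j} (Σ_{i<k} â_ij)(Σ_{l<j} â_kl)
-- becomes a sum over vertices of [top edge down][left edge left] + [bottom edge up][right edge right].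
-- Under the ice rule this weight is 1 at b₁ and b₂, 2 at c₁ and 0 elsewhere, while every
-- c₁ vertex contributes two entries −1 to Â.

module Submission where

open import Defs
open import Data.Nat as ℕ using (ℕ; zero; suc; _≤_; _∸_; _<ᵇ_)
import Data.Nat.Properties as ℕ
open import Data.Integer using (ℤ; +_; -_; _+_; _-_; _*_)
import Data.Integer.Properties as ℤ
open import Data.Integer.Tactic.RingSolver using (solve-∀)
open import Algebra.Properties.Semiring.Sum ℤ.+-*-semiring
  using (sum; sum-syntax; sum-cong-≗; sum-replicate-zero; ∑-distrib-+; ∑-comm; ∑-permute;
         *-distribˡ-sum; *-distribʳ-sum)
open import Data.Fin using (Fin; zero; suc; toℕ; inject₁; fromℕ; opposite; _↑ˡ_; _↑ʳ_; _<?_)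
open import Data.Fin.Properties using (toℕ<n; toℕ-↑ˡ; toℕ-↑ʳ; splitAt-↑ˡ; splitAt-↑ʳ)
open import Data.Fin.Permutation using (reverse)
open import Data.Bool using (Bool; true; false; if_then_else_; _∧_; _∨_; not)
open import Data.Empty using (⊥-elim)
open import Data.Bool.Properties using (T-≡)
open import Function using (_∘_; Equivalence)
open import Relation.Nullary.Decidable using (⌊_⌋; isYes≗does)
open import Relation.Binary.PropositionalEquality
open ≡-Reasoning

Σℤ≡sum : ∀ {m} (f : Fin m → ℤ) → Σℤ f ≡ sum f
Σℤ≡sum {zero}  f = refl
Σℤ≡sum {suc m} f = cong (_+_ (f zero)) (Σℤ≡sum (f ∘ suc))

+Σℕ≡sum : ∀ {m} (f : Fin m → ℕ) → + Σℕ f ≡ ∑[ i < m ] (+ f i)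
+Σℕ≡sum {zero}  f = refl
+Σℕ≡sum {suc m} f = cong (_+_ (+ f zero)) (+Σℕ≡sum (f ∘ suc))

+Σℕ²≡∑² : ∀ {a b} (F : Fin a → Fin b → ℕ) →
  + Σℕ (λ r → Σℕ (F r)) ≡ ∑[ r < a ] ∑[ p < b ] (+ F r p)
+Σℕ²≡∑² F = trans (+Σℕ≡sum (λ r → Σℕ (F r))) (sum-cong-≗ (λ r → +Σℕ≡sum (F r)))

sum-↑ˡ-↑ʳ : ∀ m {k} (f : Fin (m ℕ.+ k) → ℤ) →
  sum f ≡ ∑[ i < m ] f (i ↑ˡ k) + ∑[ j < k ] f (m ↑ʳ j)
sum-↑ˡ-↑ʳ zero    f = sym (ℤ.+-identityˡ _)
sum-↑ˡ-↑ʳ (suc m) f =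
  trans (cong (_+_ (f zero)) (sum-↑ˡ-↑ʳ m (f ∘ suc))) (sym (ℤ.+-assoc (f zero) _ _))

sum-opposite : ∀ {m} (f : Fin m → ℤ) → ∑[ i < m ] f (opposite i) ≡ sum f
sum-opposite f = sym (∑-permute f reverse)

∑²-distrib-+ : ∀ {a b} (F G : Fin a → Fin b → ℤ) →
  ∑[ r < a ] ∑[ p < b ] (F r p + G r p) ≡ ∑[ r < a ] ∑[ p < b ] F r p + ∑[ r < a ] ∑[ p < b ] G r p
∑²-distrib-+ {b = b} F G = trans (sum-cong-≗ (λ r → ∑-distrib-+ (F r) (G r)))
  (∑-distrib-+ (λ r → ∑[ p < b ] F r p) (λ r → ∑[ p < b ] G r p))

∑²-↑ˡ-↑ʳ : ∀ {a} m {k} (F : Fin a → Fin (m ℕ.+ k) → ℤ) →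
  ∑[ r < a ] ∑[ j < m ℕ.+ k ] F r j
    ≡ ∑[ r < a ] ∑[ p < m ] F r (p ↑ˡ k) + ∑[ r < a ] ∑[ q < k ] F r (m ↑ʳ q)
∑²-↑ˡ-↑ʳ m {k} F = trans (sum-cong-≗ (λ r → sum-↑ˡ-↑ʳ m (F r)))
  (∑-distrib-+ (λ r → ∑[ p < m ] F r (p ↑ˡ k)) (λ r → ∑[ q < k ] F r (m ↑ʳ q)))

∑²-opposite : ∀ {a b} (F : Fin a → Fin b → ℤ) →
  ∑[ r < a ] ∑[ p < b ] F (opposite r) (opposite p) ≡ ∑[ r < a ] ∑[ p < b ] F r p
∑²-opposite F =
  trans (sum-cong-≗ (λ r → sum-opposite (F (opposite r)))) (sum-opposite (λ r → sum (F r)))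

partialSum : ∀ {m} → (Fin m → ℤ) → ℕ → ℤ
partialSum {m} f b = ∑[ i < m ] (if toℕ i <ᵇ b then f i else + 0)

partialSum-cong : ∀ {m} {f g : Fin m → ℤ} → (∀ i → f i ≡ g i) → ∀ b →
  partialSum f b ≡ partialSum g b
partialSum-cong f≗g b = sum-cong-≗ (λ i → cong (λ x → if toℕ i <ᵇ b then x else + 0) (f≗g i))

partialSum-zero : ∀ {m} (f : Fin m → ℤ) → partialSum f 0 ≡ + 0
partialSum-zero {m} f = sum-replicate-zero m

partialSum-saturated : ∀ {m b} (f : Fin m → ℤ) → m ≤ b → partialSum f b ≡ sum f
partialSum-saturated {b = b} f m≤b = sum-cong-≗ below
  where
  below : ∀ i → (if toℕ i <ᵇ b then f i else + 0) ≡ f i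
  below i rewrite Equivalence.to T-≡ (ℕ.<⇒<ᵇ (ℕ.<-≤-trans (toℕ<n i) m≤b)) = refl

+-<ᵇ-∸ : ∀ m x b → (m ℕ.+ x <ᵇ b) ≡ (x <ᵇ b ∸ m)
+-<ᵇ-∸ zero    x b       = refl
+-<ᵇ-∸ (suc m) x zero    = refl
+-<ᵇ-∸ (suc m) x (suc b) = +-<ᵇ-∸ m x b

partialSum-↑ˡ-↑ʳ : ∀ m {k} (f : Fin (m ℕ.+ k) → ℤ) b →
  partialSum f b ≡ partialSum (f ∘ (_↑ˡ k)) b + partialSum (f ∘ (m ↑ʳ_)) (b ∸ m)
partialSum-↑ˡ-↑ʳ m {k} f b = trans (sum-↑ˡ-↑ʳ m _) (cong₂ _+_
  (sum-cong-≗ (λ i → cong (λ c → if c then f (i ↑ˡ k) else + 0) (cong (_<ᵇ b) (toℕ-↑ˡ i k))))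
  (sum-cong-≗ (λ j → cong (λ c → if c then f (m ↑ʳ j) else + 0)
    (trans (cong (_<ᵇ b) (toℕ-↑ʳ m j)) (+-<ᵇ-∸ m (toℕ j) b)))))

diff : ∀ {m} → (Fin (suc m) → ℤ) → Fin m → ℤ
diff g i = g (inject₁ i) - g (suc i)

telescope₃ : ∀ x y z → (x - y) + (y - z) ≡ x - z
telescope₃ = solve-∀

partialSum-telescope : ∀ {m} (g : Fin (suc m) → ℤ) (j : Fin m) →
  partialSum (diff g) (toℕ j) ≡ g zero - g (inject₁ j)
partialSum-telescope g zero    = trans (partialSum-zero (diff g)) (sym (ℤ.+-inverseʳ (g zero)))
partialSum-telescope g (suc j) =
  trans (cong (_+_ (diff g zero)) (partialSum-telescope (g ∘ suc) j))
        (telescope₃ (g zero) (g (suc zero)) (g (suc (inject₁ j))))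

sum-telescope : ∀ {m} (g : Fin (suc m) → ℤ) → sum (diff g) ≡ g zero - g (fromℕ m)
sum-telescope {zero}  g = sym (ℤ.+-inverseʳ (g zero))
sum-telescope {suc m} g = trans (cong (_+_ (diff g zero)) (sum-telescope (g ∘ suc)))
        (telescope₃ (g zero) (g (suc zero)) (g (suc (fromℕ m))))

opposite-inject₁ : ∀ {m} (i : Fin m) → opposite (inject₁ i) ≡ suc (opposite i)
opposite-inject₁ {suc m} zero    = refl
opposite-inject₁ {suc m} (suc i) = cong inject₁ (opposite-inject₁ i)

diff-opposite : ∀ {m} (g : Fin (suc m) → ℤ) (i : Fin m) →
  diff g (opposite i) ≡ diff (λ e → - g (opposite e)) i
diff-opposite g i = begin
  g (inject₁ (opposite i)) - g (suc (opposite i))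
    ≡⟨ sub-as-neg (g (inject₁ (opposite i))) (g (suc (opposite i))) ⟩
  - g (suc (opposite i)) - - g (inject₁ (opposite i))
    ≡⟨ cong (λ e → - g e - - g (inject₁ (opposite i))) (opposite-inject₁ i) ⟨
  - g (opposite (inject₁ i)) - - g (opposite (suc i)) ∎
  where
  sub-as-neg : ∀ x y → x - y ≡ - y - - x
  sub-as-neg = solve-∀

if-∧-* : ∀ a b (x y : ℤ) →
  (if a ∧ b then x * y else + 0) ≡ (if a then x else + 0) * (if b then y else + 0)
if-∧-* true  true  x y = refl
if-∧-* true  false x y = sym (ℤ.*-zeroʳ x)
if-∧-* false b     x y = refl

inv≡∑partialSum* : ∀ {m} (M : Fin m → Fin m → ℤ) →
  inv M ≡ ∑[ k < m ] ∑[ j < m ] (partialSum (λ i → M i j) (toℕ k) * partialSum (M k) (toℕ j))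
inv≡∑partialSum* {m} M = begin
  inv M
    ≡⟨ Σℤ≡∑ (λ i → Σℤ≡∑ (λ j → Σℤ≡∑ (λ k → Σℤ≡∑ (λ l → factor i j k l)))) ⟩
  ∑[ i < m ] ∑[ j < m ] ∑[ k < m ] ∑[ l < m ] (X i j k * Y j k l)
    ≡⟨ sum-cong-≗ (λ i → ∑-comm (λ j k → ∑[ l < m ] (X i j k * Y j k l))) ⟩
  ∑[ i < m ] ∑[ k < m ] ∑[ j < m ] ∑[ l < m ] (X i j k * Y j k l)
    ≡⟨ ∑-comm (λ i k → ∑[ j < m ] ∑[ l < m ] (X i j k * Y j k l)) ⟩
  ∑[ k < m ] ∑[ i < m ] ∑[ j < m ] ∑[ l < m ] (X i j k * Y j k l)
    ≡⟨ sum-cong-≗ (λ k → ∑-comm (λ i j → ∑[ l < m ] (X i j k * Y j k l))) ⟩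
  ∑[ k < m ] ∑[ j < m ] ∑[ i < m ] ∑[ l < m ] (X i j k * Y j k l)
    ≡⟨ sum-cong-≗ (λ k → sum-cong-≗ (λ j → product-of-sums j k)) ⟩
  ∑[ k < m ] ∑[ j < m ] (partialSum (λ i → M i j) (toℕ k) * partialSum (M k) (toℕ j)) ∎
  where
  X : Fin m → Fin m → Fin m → ℤ
  X i j k = if toℕ i <ᵇ toℕ k then M i j else + 0
  Y : Fin m → Fin m → Fin m → ℤ
  Y j k l = if toℕ l <ᵇ toℕ j then M k l else + 0
  Σℤ≡∑ : {f g : Fin m → ℤ} → (∀ i → f i ≡ g i) → Σℤ f ≡ sum g
  Σℤ≡∑ {f} f≗g = trans (Σℤ≡sum f) (sum-cong-≗ f≗g)
  factor : ∀ i j k l →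
    (if ⌊ i <? k ⌋ ∧ ⌊ l <? j ⌋ then M i j * M k l else + 0) ≡ X i j k * Y j k l
  factor i j k l =
    trans (cong₂ (λ a b → if a ∧ b then M i j * M k l else + 0) (isYes≗does (i <? k)) (isYes≗does (l <? j)))
          (if-∧-* (toℕ i <ᵇ toℕ k) (toℕ l <ᵇ toℕ j) (M i j) (M k l))
  product-of-sums : ∀ j k →
    ∑[ i < m ] ∑[ l < m ] (X i j k * Y j k l) ≡ sum (λ i → X i j k) * sum (Y j k)
  product-of-sums j k =
    trans (sum-cong-≗ (λ i → sym (*-distribˡ-sum (X i j k) (Y j k))))
          (sym (*-distribʳ-sum (sum (Y j k)) (λ i → X i j k)))

𝟙 : Bool → ℤ
𝟙 b = + ind b

𝟙-≢ : ∀ {x y} → x ≢ y → 𝟙 x + 𝟙 y ≡ + 1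
𝟙-≢ {true}  {true}  x≢y = ⊥-elim (x≢y refl)
𝟙-≢ {true}  {false} _   = refl
𝟙-≢ {false} {true}  _   = refl
𝟙-≢ {false} {false} x≢y = ⊥-elim (x≢y refl)

-- Indexed by the left, right, top and bottom edge, encoded as in Orientation.
data IceVertex : Bool → Bool → Bool → Bool → Set where
  a₁ : IceVertex true  true  true  true
  a₂ : IceVertex false false false false
  b₁ : IceVertex true  true  false false
  b₂ : IceVertex false false true  true
  c₁ : IceVertex false true  true  false
  c₂ : IceVertex true  false false true

-- inDeg o r p and vEntry o r p unfold to these, applied to L o r p, R o r p, T o r p, B o r p.
inDegree : Bool → Bool → Bool → Bool → ℕ
inDegree l r t b = (if l then 1 else 0) ℕ.+ (if not r then 1 else 0)
                 ℕ.+ (if t then 1 else 0) ℕ.+ (if not b then 1 else 0)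

entry : Bool → Bool → Bool → Bool → ℤ
entry l r t b = if l ∧ not r ∧ not t ∧ b then + 1 else (if not l ∧ r ∧ t ∧ not b then - (+ 1) else + 0)

iceVertex : ∀ l r t b → inDegree l r t b ≡ 2 → IceVertex l r t b
iceVertex true  true  true  true  _  = a₁
iceVertex false false false false _  = a₂
iceVertex true  true  false false _  = b₁
iceVertex false false true  true  _  = b₂
iceVertex false true  true  false _  = c₁
iceVertex true  false false true  _  = c₂
iceVertex true  true  true  false ()
iceVertex true  true  false true  ()
iceVertex true  false true  true  ()
iceVertex true  false true  false ()
iceVertex true  false false false ()
iceVertex false true  true  true  ()
iceVertex false true  false true  ()
iceVertex false true  false false ()
iceVertex false false true  false ()
iceVertex false false false true  ()

module _ {l r t b : Bool} where

  entry-horizontal : IceVertex l r t b → entry l r t b ≡ 𝟙 l - 𝟙 r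
  entry-horizontal a₁ = refl
  entry-horizontal a₂ = refl
  entry-horizontal b₁ = refl
  entry-horizontal b₂ = refl
  entry-horizontal c₁ = refl
  entry-horizontal c₂ = refl

  -- in this shape the column entries are the diff of the heights e ↦ - 𝟙 (V p e)
  entry-vertical : IceVertex l r t b → entry l r t b ≡ - 𝟙 t - - 𝟙 b
  entry-vertical a₁ = refl
  entry-vertical a₂ = refl
  entry-vertical b₁ = refl
  entry-vertical b₂ = refl
  entry-vertical c₁ = refl
  entry-vertical c₂ = refl

  isMinusOne-entry : IceVertex l r t b → 𝟙 (isMinusOne (entry l r t b)) ≡ 𝟙 (not l ∧ r ∧ t ∧ not b)
  isMinusOne-entry a₁ = refl
  isMinusOne-entry a₂ = refl
  isMinusOne-entry b₁ = refl
  isMinusOne-entry b₂ = refl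
  isMinusOne-entry c₁ = refl
  isMinusOne-entry c₂ = refl

  vertexWeight : IceVertex l r t b →
    𝟙 ((l ∧ r ∧ not t ∧ not b) ∨ (not l ∧ not r ∧ t ∧ b))
      + 𝟙 (not l ∧ r ∧ t ∧ not b) + 𝟙 (not l ∧ r ∧ t ∧ not b)
    ≡ 𝟙 t * (+ 1 - 𝟙 l) + (+ 1 - 𝟙 b) * 𝟙 r
  vertexWeight a₁ = refl
  vertexWeight a₂ = refl
  vertexWeight b₁ = refl
  vertexWeight b₂ = refl
  vertexWeight c₁ = refl
  vertexWeight c₂ = refl

module VertexSums {n : ℕ} (o : Orientation n) where
  open Orientation o

  vertexSum : (Fin (n ℕ.+ n) → Fin n → ℤ) → ℤ
  vertexSum F = ∑[ r < n ℕ.+ n ] ∑[ p < n ] F r p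

  typeB typeC₁ leftWeight rightWeight : Fin (n ℕ.+ n) → Fin n → ℤ
  typeB r p       = 𝟙 (isB₁ o r p ∨ isB₂ o r p)
  typeC₁ r p      = 𝟙 (isC₁ o r p)
  leftWeight r p  = 𝟙 (T o r p) * (+ 1 - 𝟙 (L o r p))
  rightWeight r p = (+ 1 - 𝟙 (B o r p)) * 𝟙 (R o r p)

  bCount≡vertexSum : + bCount o ≡ vertexSum typeB
  bCount≡vertexSum = +Σℕ²≡∑² (λ r p → ind (isB₁ o r p ∨ isB₂ o r p))

  module _ (adm : Admissible o) where
    open Admissible adm

    vertexType : ∀ r p → IceVertex (L o r p) (R o r p) (T o r p) (B o r p)
    vertexType r p = iceVertex _ _ _ _ (ice r p)

    Ahat-↑ˡ : ∀ r p → Ahat o r (p ↑ˡ n) ≡ vEntry o r p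
    Ahat-↑ˡ r p rewrite splitAt-↑ˡ n p n = refl

    Ahat-↑ʳ : ∀ r q → Ahat o r (n ↑ʳ q) ≡ vEntry o (opposite r) (opposite q)
    Ahat-↑ʳ r q rewrite splitAt-↑ʳ n n q = refl

    row-↑ˡ : ∀ k p → Ahat o k (p ↑ˡ n) ≡ diff (𝟙 ∘ H k) p
    row-↑ˡ k p = trans (Ahat-↑ˡ k p) (entry-horizontal (vertexType k p))

    row-↑ʳ : ∀ k q → Ahat o k (n ↑ʳ q) ≡ diff (λ e → - 𝟙 (H (opposite k) (opposite e))) q
    row-↑ʳ k q = trans (Ahat-↑ʳ k q) (trans (entry-horizontal (vertexType (opposite k) (opposite q)))
      (diff-opposite (𝟙 ∘ H (opposite k)) q))

    column-↑ˡ : ∀ i p → Ahat o i (p ↑ˡ n) ≡ diff (λ e → - 𝟙 (V p e)) i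
    column-↑ˡ i p = trans (Ahat-↑ˡ i p) (entry-vertical (vertexType i p))

    column-↑ʳ : ∀ i q → Ahat o i (n ↑ʳ q) ≡ diff (λ e → - - 𝟙 (V (opposite q) (opposite e))) i
    column-↑ʳ i q = trans (Ahat-↑ʳ i q) (trans (entry-vertical (vertexType (opposite i) (opposite q)))
      (diff-opposite (λ e → - 𝟙 (V (opposite q) e)) i))

    rowPrefix-↑ˡ : ∀ k p → partialSum (Ahat o k) (toℕ (p ↑ˡ n)) ≡ + 1 - 𝟙 (L o k p)
    rowPrefix-↑ˡ k p = begin
      partialSum (Ahat o k) (toℕ (p ↑ˡ n))
        ≡⟨ cong (partialSum (Ahat o k)) (toℕ-↑ˡ p n) ⟩
      partialSum (Ahat o k) (toℕ p)
        ≡⟨ partialSum-↑ˡ-↑ʳ n (Ahat o k) (toℕ p) ⟩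
      partialSum (λ p′ → Ahat o k (p′ ↑ˡ n)) (toℕ p) + partialSum (λ q → Ahat o k (n ↑ʳ q)) (toℕ p ∸ n)
        ≡⟨ cong₂ _+_ (partialSum-cong (row-↑ˡ k) (toℕ p)) right-half-empty ⟩
      partialSum (diff (𝟙 ∘ H k)) (toℕ p) + + 0
        ≡⟨ ℤ.+-identityʳ _ ⟩
      partialSum (diff (𝟙 ∘ H k)) (toℕ p)
        ≡⟨ partialSum-telescope (𝟙 ∘ H k) p ⟩
      𝟙 (H k zero) - 𝟙 (L o k p)
        ≡⟨ cong (λ x → 𝟙 x - 𝟙 (L o k p)) (leftIn k) ⟩
      + 1 - 𝟙 (L o k p) ∎
      where
      right-half : Fin n → ℤ
      right-half q = Ahat o k (n ↑ʳ q)
      right-half-empty : partialSum right-half (toℕ p ∸ n) ≡ + 0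
      right-half-empty = trans (cong (partialSum right-half) (ℕ.m≤n⇒m∸n≡0 (ℕ.<⇒≤ (toℕ<n p))))
                               (partialSum-zero right-half)

    rowPrefix-↑ʳ : ∀ k q → partialSum (Ahat o k) (toℕ (n ↑ʳ q)) ≡ 𝟙 (R o (opposite k) (opposite q))
    rowPrefix-↑ʳ k q = begin
      partialSum (Ahat o k) (toℕ (n ↑ʳ q))
        ≡⟨ cong (partialSum (Ahat o k)) (toℕ-↑ʳ n q) ⟩
      partialSum (Ahat o k) (n ℕ.+ toℕ q)
        ≡⟨ partialSum-↑ˡ-↑ʳ n (Ahat o k) (n ℕ.+ toℕ q) ⟩
      partialSum (λ p → Ahat o k (p ↑ˡ n)) (n ℕ.+ toℕ q)
        + partialSum (λ q′ → Ahat o k (n ↑ʳ q′)) (n ℕ.+ toℕ q ∸ n)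
        ≡⟨ cong₂ _+_ (partialSum-saturated _ (ℕ.m≤m+n n (toℕ q)))
                     (cong (partialSum (λ q′ → Ahat o k (n ↑ʳ q′))) (ℕ.m+n∸m≡n n (toℕ q))) ⟩
      sum (λ p → Ahat o k (p ↑ˡ n)) + partialSum (λ q′ → Ahat o k (n ↑ʳ q′)) (toℕ q)
        ≡⟨ cong₂ _+_ (trans (sum-cong-≗ (row-↑ˡ k)) (sum-telescope (𝟙 ∘ H k)))
                     (trans (partialSum-cong (row-↑ʳ k) (toℕ q)) (partialSum-telescope g q)) ⟩
      (𝟙 (H k zero) - x) + (- y - - 𝟙 (H k′ (opposite (inject₁ q))))
        ≡⟨ cong₂ (λ a e → (𝟙 a - x) + (- y - - 𝟙 (H k′ e))) (leftIn k) (opposite-inject₁ q) ⟩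
      (+ 1 - x) + (- y - - 𝟙 (R o k′ (opposite q)))
        ≡⟨ cong (λ a → (a - x) + (- y - - 𝟙 (R o k′ (opposite q)))) (sym (𝟙-≢ (bend k))) ⟩
      (x + y - x) + (- y - - 𝟙 (R o k′ (opposite q)))
        ≡⟨ cancel x y (𝟙 (R o k′ (opposite q))) ⟩
      𝟙 (R o k′ (opposite q)) ∎
      where
      k′ = opposite k
      g : Fin (suc n) → ℤ
      g e = - 𝟙 (H k′ (opposite e))
      x = 𝟙 (H k (fromℕ n))
      y = 𝟙 (H k′ (fromℕ n))
      cancel : ∀ x y z → (x + y - x) + (- y - - z) ≡ z
      cancel = solve-∀

    columnPrefix-↑ˡ : ∀ k p → partialSum (λ i → Ahat o i (p ↑ˡ n)) (toℕ k) ≡ 𝟙 (T o k p)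
    columnPrefix-↑ˡ k p = begin
      partialSum (λ i → Ahat o i (p ↑ˡ n)) (toℕ k)
        ≡⟨ partialSum-cong (λ i → column-↑ˡ i p) (toℕ k) ⟩
      partialSum (diff (λ e → - 𝟙 (V p e))) (toℕ k)
        ≡⟨ partialSum-telescope (λ e → - 𝟙 (V p e)) k ⟩
      - 𝟙 (V p zero) - - 𝟙 (T o k p)
        ≡⟨ cong (λ a → - 𝟙 a - - 𝟙 (T o k p)) (topUp p) ⟩
      - + 0 - - 𝟙 (T o k p)
        ≡⟨ cancel (𝟙 (T o k p)) ⟩
      𝟙 (T o k p) ∎
      where
      cancel : ∀ x → - + 0 - - x ≡ x
      cancel = solve-∀

    columnPrefix-↑ʳ : ∀ k q →
      partialSum (λ i → Ahat o i (n ↑ʳ q)) (toℕ k) ≡ + 1 - 𝟙 (B o (opposite k) (opposite q))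
    columnPrefix-↑ʳ k q = begin
      partialSum (λ i → Ahat o i (n ↑ʳ q)) (toℕ k)
        ≡⟨ partialSum-cong (λ i → column-↑ʳ i q) (toℕ k) ⟩
      partialSum (diff g) (toℕ k)
        ≡⟨ partialSum-telescope g k ⟩
      - - 𝟙 (V q′ (fromℕ (n ℕ.+ n))) - - - 𝟙 (V q′ (opposite (inject₁ k)))
        ≡⟨ cong₂ (λ a e → - - 𝟙 a - - - 𝟙 (V q′ e)) (bottomDn q′) (opposite-inject₁ k) ⟩
      - - + 1 - - - 𝟙 (B o (opposite k) q′)
        ≡⟨ cancel (𝟙 (B o (opposite k) q′)) ⟩
      + 1 - 𝟙 (B o (opposite k) q′) ∎
      where
      q′ = opposite q
      g : Fin (suc (n ℕ.+ n)) → ℤ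
      g e = - - 𝟙 (V q′ (opposite e))
      cancel : ∀ x → - - + 1 - - - x ≡ + 1 - x
      cancel = solve-∀

    inv-Ahat : inv (Ahat o) ≡ vertexSum leftWeight + vertexSum rightWeight
    inv-Ahat = begin
      inv (Ahat o)
        ≡⟨ inv≡∑partialSum* (Ahat o) ⟩
      ∑[ k < n ℕ.+ n ] ∑[ j < n ℕ.+ n ] P k j
        ≡⟨ ∑²-↑ˡ-↑ʳ n P ⟩
      vertexSum (λ k p → P k (p ↑ˡ n)) + vertexSum (λ k q → P k (n ↑ʳ q))
        ≡⟨ cong₂ _+_
             (sum-cong-≗ (λ k → sum-cong-≗ (λ p → cong₂ _*_ (columnPrefix-↑ˡ k p) (rowPrefix-↑ˡ k p))))
             (sum-cong-≗ (λ k → sum-cong-≗ (λ q → cong₂ _*_ (columnPrefix-↑ʳ k q) (rowPrefix-↑ʳ k q)))) ⟩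
      vertexSum leftWeight + vertexSum (λ k q → rightWeight (opposite k) (opposite q))
        ≡⟨ cong (_+_ (vertexSum leftWeight)) (∑²-opposite rightWeight) ⟩
      vertexSum leftWeight + vertexSum rightWeight ∎
      where
      P : Fin (n ℕ.+ n) → Fin (n ℕ.+ n) → ℤ
      P k j = partialSum (λ i → Ahat o i j) (toℕ k) * partialSum (Ahat o k) (toℕ j)

    negCount-Ahat : + negCount (Ahat o) ≡ vertexSum typeC₁ + vertexSum typeC₁
    negCount-Ahat = begin
      + negCount (Ahat o)
        ≡⟨ +Σℕ²≡∑² (λ i j → ind (isMinusOne (Ahat o i j))) ⟩
      ∑[ i < n ℕ.+ n ] ∑[ j < n ℕ.+ n ] N i j
        ≡⟨ ∑²-↑ˡ-↑ʳ n N ⟩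
      vertexSum (λ r p → N r (p ↑ˡ n)) + vertexSum (λ r q → N r (n ↑ʳ q))
        ≡⟨ cong₂ _+_
             (sum-cong-≗ (λ r → sum-cong-≗ (λ p →
               trans (cong (𝟙 ∘ isMinusOne) (Ahat-↑ˡ r p)) (isMinusOne-entry (vertexType r p)))))
             (sum-cong-≗ (λ r → sum-cong-≗ (λ q →
               trans (cong (𝟙 ∘ isMinusOne) (Ahat-↑ʳ r q))
                     (isMinusOne-entry (vertexType (opposite r) (opposite q)))))) ⟩
      vertexSum typeC₁ + vertexSum (λ r q → typeC₁ (opposite r) (opposite q))
        ≡⟨ cong (_+_ (vertexSum typeC₁)) (∑²-opposite typeC₁) ⟩
      vertexSum typeC₁ + vertexSum typeC₁ ∎
      where
      N : Fin (n ℕ.+ n) → Fin (n ℕ.+ n) → ℤ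
      N i j = 𝟙 (isMinusOne (Ahat o i j))

    vertexSum-weight :
      vertexSum typeB + vertexSum typeC₁ + vertexSum typeC₁ ≡ vertexSum leftWeight + vertexSum rightWeight
    vertexSum-weight = begin
      vertexSum typeB + vertexSum typeC₁ + vertexSum typeC₁
        ≡⟨ cong (_+ vertexSum typeC₁) (∑²-distrib-+ typeB typeC₁) ⟨
      vertexSum (λ r p → typeB r p + typeC₁ r p) + vertexSum typeC₁
        ≡⟨ ∑²-distrib-+ (λ r p → typeB r p + typeC₁ r p) typeC₁ ⟨
      vertexSum (λ r p → typeB r p + typeC₁ r p + typeC₁ r p)
        ≡⟨ sum-cong-≗ (λ r → sum-cong-≗ (λ p → vertexWeight (vertexType r p))) ⟩
      vertexSum (λ r p → leftWeight r p + rightWeight r p)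
        ≡⟨ ∑²-distrib-+ leftWeight rightWeight ⟩
      vertexSum leftWeight + vertexSum rightWeight ∎

mainTheorem8 : (n : ℕ) → 1 ≤ n → (o : Orientation n) → Admissible o →
    + bCount o ≡ inv (Ahat o) - + negCount (Ahat o)
mainTheorem8 n _ o adm = begin
  + bCount o
    ≡⟨ bCount≡vertexSum ⟩
  b
    ≡⟨ add-sub-cancel b c ⟩
  b + c + c - (c + c)
    ≡⟨ cong₂ _-_ (vertexSum-weight adm) (sym (negCount-Ahat adm)) ⟩
  vertexSum leftWeight + vertexSum rightWeight - + negCount (Ahat o)
    ≡⟨ cong (_- + negCount (Ahat o)) (inv-Ahat adm) ⟨
  inv (Ahat o) - + negCount (Ahat o) ∎
  where
  open VertexSums o
  b = vertexSum typeB
  c = vertexSum typeC₁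
  add-sub-cancel : ∀ x y → x ≡ x + y + y - (y + y)
  add-sub-cancel = solve-∀
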